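{- Let $C$ be a cycle and $P$ a path, edge-disjoint from each other, such that the graph $C\cup P$ is an exceptional graph. Then $C$ has length $5$, $V(C)\subseteq V(P)$, and the subgraph of $C\cup P$ induced by $V(C)$ is isomorphic to $K_5^-$.
   Context: $K_5^-$ denotes $K_5$ minus one edge. An exceptional graph is a graph that is the union of a cycle $C'$ of length $5$ and a path $P'$ (edge-disjoint) such that $V(C')\subseteq V(P')$ and $V(C')$ induces a $K_5^-$ in $C'\cup P'$. Graphs are simple; a path has pairwise distinct vertices. -}

module Defs where

open import Data.Nat using (ℕ; _≤_)
open import Data.Fin using (Fin)
open import Data.List using (List; []; _∷_; _++_; [_]; length)
open import Data.List.Membership.Propositional using (_∈_)
open import Data.List.Relation.Unary.Unique.Propositional using (Unique)
open import Data.Product using (_×_; ∃; ∃-syntax; Σ-syntax)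
open import Data.Sum using (_⊎_)
open import Data.Empty using (⊥)
open import Relation.Nullary using (¬_)
open import Relation.Binary.PropositionalEquality using (_≡_; _≢_)
open import Function.Bundles using (_⇔_)
open import Function.Definitions using (Injective)

-- Vertices are natural numbers.  A path is given by its (nonempty) list of
-- pairwise distinct vertices; a cycle by its list of pairwise distinct
-- vertices (at least 3), in cyclic order.

Consec : List ℕ → ℕ → ℕ → Set
Consec (a ∷ b ∷ rest) x y = (x ≡ a × y ≡ b) ⊎ Consec (b ∷ rest) x y
Consec _ _ _ = ⊥

IsPath : List ℕ → Set
IsPath vs = Unique vs × vs ≢ []

IsCycle : List ℕ → Set
IsCycle vs = Unique vs × 3 ≤ length vs

PathAdj : List ℕ → ℕ → ℕ → Set
PathAdj vs x y = Consec vs x y ⊎ Consec vs y x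

closeUp : List ℕ → List ℕ
closeUp [] = []
closeUp (a ∷ rest) = a ∷ rest ++ [ a ]

CycleAdj : List ℕ → ℕ → ℕ → Set
CycleAdj vs = PathAdj (closeUp vs)

EdgeDisjoint : List ℕ → List ℕ → Set
EdgeDisjoint C P = ∀ x y → CycleAdj C x y → PathAdj P x y → ⊥

UVert : List ℕ → List ℕ → ℕ → Set
UVert C P v = v ∈ C ⊎ v ∈ P

UAdj : List ℕ → List ℕ → ℕ → ℕ → Set
UAdj C P x y = CycleAdj C x y ⊎ PathAdj P x y

SameUnion : List ℕ → List ℕ → List ℕ → List ℕ → Set
SameUnion C P C' P' =
  (∀ v → UVert C P v ⇔ UVert C' P' v) × (∀ x y → UAdj C P x y ⇔ UAdj C' P' x y)

K5⁻Adj : Fin 5 → Fin 5 → Set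
K5⁻Adj i j = i ≢ j × ¬ ((i ≡ Fin.zero × j ≡ Fin.suc Fin.zero) ⊎ (i ≡ Fin.suc Fin.zero × j ≡ Fin.zero))
  where import Data.Fin as Fin

InducesK5⁻ : (ℕ → ℕ → Set) → List ℕ → Set
InducesK5⁻ Adj S =
  Σ[ f ∈ (Fin 5 → ℕ) ]
    Injective _≡_ _≡_ f
    × (∀ v → v ∈ S ⇔ (∃[ i ] f i ≡ v))
    × (∀ i j → i ≢ j → (Adj (f i) (f j) ⇔ K5⁻Adj i j))

Exceptional : List ℕ → List ℕ → Set
Exceptional C P =
  ∃[ C' ] ∃[ P' ]
    IsCycle C' × length C' ≡ 5 × IsPath P' × EdgeDisjoint C' P'
    × (∀ v → v ∈ C' → v ∈ P')
    × InducesK5⁻ (UAdj C' P') C'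
    × SameUnion C P C' P'

-- Let C ∪ P = C′ ∪ P′ witness exceptionality, and let f enumerate S = V(C′) so that the union
-- induces K₅⁻ on S with missing edge {f 0, f 1}.  In the union of a cycle and a path, a vertex
-- lying on only one of them has degree at most 2, whereas every vertex of S has three neighbours
-- in S; hence S ⊆ V(C) ∩ V(P).  At any vertex the cycle C′ accounts for at most two edges, so
-- every vertex of S has a P′-neighbour in S, and the three vertices of degree 4 have both their
-- P′-predecessor and P′-successor in S.  A vertex of C outside S is incident in C′ ∪ P′ only to
-- P′-edges, so its two C-edges make it an inner vertex of P′ with both P′-neighbours on C.
-- Suppose V(C) ⊄ S and let y be the first vertex of C ∖ S along P′: its P′-predecessor x lies on
-- C, hence in S, and P′ leaves S at x.  Then x and the first and the last vertex of C along P′ are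
-- three distinct vertices that all have to be ends of the missing edge, which is absurd.  So
-- V(C) = S, and everything transfers from C′ to C.

module Submission where

open import Defs
open import Data.Empty using (⊥-elim)
open import Data.Fin as Fin using (Fin; zero; suc; #_)
open import Data.Nat using (ℕ; _≤_; s≤s; z≤n; _≟_)
open import Data.List.Membership.DecPropositional _≟_ using (_∈?_)
open import Data.List using (List; []; _∷_; _++_; [_]; length)
open import Data.List.Membership.Propositional using (_∈_; _∉_; lose)
open import Data.List.Membership.Propositional.Properties using (∈-++⁺ˡ; ∈-++⁺ʳ; ∈-++⁻)
open import Data.List.Membership.Propositional.Properties.WithK using (unique∧set⇒bag)
open import Data.List.Relation.Binary.BagAndSetEquality using (∼bag⇒↭)
open import Data.List.Relation.Binary.Permutation.Propositional.Properties using (↭-length)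
import Data.List.Relation.Unary.All as All
open import Data.List.Relation.Unary.All.Properties using (All¬⇒¬Any)
open import Data.List.Relation.Unary.AllPairs using ([]; _∷_)
open import Data.List.Relation.Unary.Any using (Any; here; there; any?)
open import Data.List.Relation.Unary.Unique.Propositional using (Unique)
open import Data.List.Relation.Unary.Unique.Propositional.Properties using (++⁺)
open import Data.Product using (_×_; _,_; proj₁; proj₂; ∃-syntax; ∃₂)
import Data.Product as Product
open import Data.Sum using (_⊎_; inj₁; inj₂)
import Data.Sum as Sum
open import Function using (_∘_; id)
open import Function.Bundles using (_⇔_; mk⇔; Equivalence)
open import Function.Construct.Composition using (_⇔-∘_)
open import Function.Definitions using (Injective)
open import Relation.Binary using (Decidable)
open import Relation.Binary.PropositionalEquality using (_≡_; _≢_; refl; sym; trans; subst)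
open import Relation.Nullary using (¬_; yes; no)
open import Relation.Nullary.Decidable using (True; toWitness; ¬?; _×-dec_; _⊎-dec_; decidable-stable)
import Relation.Unary as U

open Equivalence

private variable
  A B : Set
  a x y z : ℕ

AtMostOne : (A → Set) → Set
AtMostOne R = ∀ {a b} → R a → R b → a ≡ b

Consec⇒∈ˡ : ∀ xs → Consec xs x y → x ∈ xs
Consec⇒∈ˡ (a ∷ b ∷ r) (inj₁ (refl , refl)) = here refl
Consec⇒∈ˡ (a ∷ b ∷ r) (inj₂ c) = there (Consec⇒∈ˡ (b ∷ r) c)

Consec-∷⇒∈ʳ : ∀ a xs → Consec (a ∷ xs) x y → y ∈ xs
Consec-∷⇒∈ʳ a (b ∷ r) (inj₁ (refl , refl)) = here refl
Consec-∷⇒∈ʳ a (b ∷ r) (inj₂ c) = there (Consec-∷⇒∈ʳ b r c)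

Consec⇒∈ʳ : ∀ xs → Consec xs x y → y ∈ xs
Consec⇒∈ʳ (a ∷ r) c = there (Consec-∷⇒∈ʳ a r c)

Consec-∷⁻ : ∀ a xs → Consec (a ∷ xs) x y → x ≡ a ⊎ Consec xs x y
Consec-∷⁻ a (b ∷ r) (inj₁ (e , _)) = inj₁ e
Consec-∷⁻ a (b ∷ r) (inj₂ c) = inj₂ c

Consec-functionalʳ : ∀ xs → Unique xs → AtMostOne (Consec xs x)
Consec-functionalʳ (a ∷ b ∷ r) u (inj₁ (refl , refl)) (inj₁ (refl , refl)) = refl
Consec-functionalʳ (a ∷ b ∷ r) (a∉ ∷ u) (inj₁ (refl , refl)) (inj₂ c) = ⊥-elim (All¬⇒¬Any a∉ (Consec⇒∈ˡ (b ∷ r) c))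
Consec-functionalʳ (a ∷ b ∷ r) (a∉ ∷ u) (inj₂ c) (inj₁ (refl , refl)) = ⊥-elim (All¬⇒¬Any a∉ (Consec⇒∈ˡ (b ∷ r) c))
Consec-functionalʳ (a ∷ b ∷ r) (_ ∷ u) (inj₂ c) (inj₂ d) = Consec-functionalʳ (b ∷ r) u c d

-- Only the tail need be duplicate-free, so that this also covers the closed walk of a cycle.
Consec-∷-functionalˡ : ∀ a xs → Unique xs → AtMostOne (λ y → Consec (a ∷ xs) y x)
Consec-∷-functionalˡ a (b ∷ r) u (inj₁ (refl , refl)) (inj₁ (refl , refl)) = refl
Consec-∷-functionalˡ a (b ∷ r) (b∉ ∷ u) (inj₁ (refl , refl)) (inj₂ c) = ⊥-elim (All¬⇒¬Any b∉ (Consec-∷⇒∈ʳ b r c))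
Consec-∷-functionalˡ a (b ∷ r) (b∉ ∷ u) (inj₂ c) (inj₁ (refl , refl)) = ⊥-elim (All¬⇒¬Any b∉ (Consec-∷⇒∈ʳ b r c))
Consec-∷-functionalˡ a (b ∷ r) (_ ∷ u) (inj₂ c) (inj₂ d) = Consec-∷-functionalˡ b r u c d

Consec-functionalˡ : ∀ xs → Unique xs → AtMostOne (λ y → Consec xs y x)
Consec-functionalˡ (a ∷ r) (_ ∷ u) = Consec-∷-functionalˡ a r u

PathAdj-distinct⇒pred×succ : ∀ {Q : ℕ → Set} xs → Unique xs → y ≢ z → Q y → Q z
  → PathAdj xs x y → PathAdj xs x z → (∃[ w ] Q w × Consec xs w x) × (∃[ w ] Q w × Consec xs x w)
PathAdj-distinct⇒pred×succ xs u y≢z qy qz (inj₁ x→y) (inj₂ z→x) = (_ , qz , z→x) , (_ , qy , x→y)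
PathAdj-distinct⇒pred×succ xs u y≢z qy qz (inj₂ y→x) (inj₁ x→z) = (_ , qy , y→x) , (_ , qz , x→z)
PathAdj-distinct⇒pred×succ xs u y≢z qy qz (inj₁ x→y) (inj₁ x→z) = ⊥-elim (y≢z (Consec-functionalʳ xs u x→y x→z))
PathAdj-distinct⇒pred×succ xs u y≢z qy qz (inj₂ y→x) (inj₂ z→x) = ⊥-elim (y≢z (Consec-functionalˡ xs u y→x z→x))

Consec-asym : ∀ xs → Unique xs → Consec xs x y → ¬ Consec xs y x
Consec-asym (a ∷ b ∷ r) (a∉ ∷ u) (inj₁ (refl , refl)) (inj₁ (refl , _)) = All¬⇒¬Any a∉ (here refl)
Consec-asym (a ∷ b ∷ r) (a∉ ∷ u) (inj₁ (refl , refl)) (inj₂ c) = All¬⇒¬Any a∉ (there (Consec-∷⇒∈ʳ b r c))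
Consec-asym (a ∷ b ∷ r) (a∉ ∷ u) (inj₂ c) (inj₁ (refl , refl)) = All¬⇒¬Any a∉ (there (Consec-∷⇒∈ʳ b r c))
Consec-asym (a ∷ b ∷ r) (_ ∷ u) (inj₂ c) (inj₂ d) = Consec-asym (b ∷ r) u c d

Unique-∷ʳ : ∀ {xs} → Unique xs → a ∉ xs → Unique (xs ++ [ a ])
Unique-∷ʳ u a∉ = ++⁺ u (All.[] ∷ []) λ where (a∈ , here refl) → a∉ a∈

Consec-∷ʳ⇒∈ˡ : ∀ xs → Consec (xs ++ [ z ]) x y → x ∈ xs
Consec-∷ʳ⇒∈ˡ (a ∷ []) (inj₁ (refl , _)) = here refl
Consec-∷ʳ⇒∈ˡ (a ∷ b ∷ r) (inj₁ (refl , _)) = here refl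
Consec-∷ʳ⇒∈ˡ (a ∷ b ∷ r) (inj₂ c) = there (Consec-∷ʳ⇒∈ˡ (b ∷ r) c)

Consec-∷ʳ⁻ : ∀ xs → Unique xs → Consec (xs ++ [ z ]) x y
  → Consec xs x y ⊎ (y ≡ z × ∀ w → ¬ Consec xs x w)
Consec-∷ʳ⁻ (a ∷ []) u (inj₁ (refl , refl)) = inj₂ (refl , λ _ ())
Consec-∷ʳ⁻ (a ∷ b ∷ r) u (inj₁ (refl , refl)) = inj₁ (inj₁ (refl , refl))
Consec-∷ʳ⁻ (a ∷ b ∷ r) (a∉ ∷ u) (inj₂ c) with Consec-∷ʳ⁻ (b ∷ r) u c
... | inj₁ d = inj₁ (inj₂ d)
... | inj₂ (refl , last) = inj₂ (refl , λ where
  w (inj₁ (refl , _)) → All¬⇒¬Any a∉ (Consec-∷ʳ⇒∈ˡ (b ∷ r) c)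
  w (inj₂ d) → last w d)

Consec-∷ʳ-successor : ∀ xs → x ∈ xs → ∃[ s ] Consec (xs ++ [ z ]) x s
Consec-∷ʳ-successor (a ∷ []) (here refl) = _ , inj₁ (refl , refl)
Consec-∷ʳ-successor (a ∷ b ∷ r) (here refl) = b , inj₁ (refl , refl)
Consec-∷ʳ-successor (a ∷ b ∷ r) (there x∈) = Product.map₂ inj₂ (Consec-∷ʳ-successor (b ∷ r) x∈)

Consec-∷-predecessor : ∀ a xs → x ∈ xs → ∃[ p ] Consec (a ∷ xs) p x
Consec-∷-predecessor a (b ∷ r) (here refl) = a , inj₁ (refl , refl)
Consec-∷-predecessor a (b ∷ r) (there x∈) = Product.map₂ inj₂ (Consec-∷-predecessor b r x∈)

∈-closeUp⁻ : ∀ xs → x ∈ closeUp xs → x ∈ xs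
∈-closeUp⁻ (c ∷ r) (here e) = here e
∈-closeUp⁻ (c ∷ r) (there x∈) with ∈-++⁻ r x∈
... | inj₁ x∈r = there x∈r
... | inj₂ (here e) = here e

closeUp-functionalʳ : ∀ xs → Unique xs → AtMostOne (Consec (closeUp xs) x)
closeUp-functionalʳ (c ∷ r) u h h′ with Consec-∷ʳ⁻ (c ∷ r) u h | Consec-∷ʳ⁻ (c ∷ r) u h′
... | inj₁ d | inj₁ d′ = Consec-functionalʳ (c ∷ r) u d d′
... | inj₁ d | inj₂ (_ , last) = ⊥-elim (last _ d)
... | inj₂ (_ , last) | inj₁ d′ = ⊥-elim (last _ d′)
... | inj₂ (e , _) | inj₂ (e′ , _) = trans e (sym e′)

closeUp-functionalˡ : ∀ xs → Unique xs → AtMostOne (λ y → Consec (closeUp xs) y x)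
closeUp-functionalˡ (c ∷ r) (c∉ ∷ u) = Consec-∷-functionalˡ c (r ++ [ c ]) (Unique-∷ʳ u (All¬⇒¬Any c∉))

-- A cycle needs three vertices for the closed walk not to traverse an edge back and forth.
closeUp-asym : ∀ xs → Unique xs → 3 ≤ length xs → Consec (closeUp xs) x y → ¬ Consec (closeUp xs) y x
closeUp-asym xs@(c ∷ c₁ ∷ c₂ ∷ r) u (s≤s (s≤s (s≤s z≤n))) h h′
  with Consec-∷ʳ⁻ xs u h | Consec-∷ʳ⁻ xs u h′
... | inj₁ d | inj₁ d′ = Consec-asym xs u d d′
... | inj₁ d | inj₂ (refl , last) with Consec-functionalʳ xs u d (inj₁ (refl , refl))
...   | refl = last c₂ (inj₂ (inj₁ (refl , refl)))
closeUp-asym xs@(c ∷ c₁ ∷ c₂ ∷ r) u _ h h′ | inj₂ (refl , last) | inj₁ d′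
  with Consec-functionalʳ xs u d′ (inj₁ (refl , refl))
...   | refl = last c₂ (inj₂ (inj₁ (refl , refl)))
closeUp-asym (c ∷ c₁ ∷ c₂ ∷ r) u _ h h′ | inj₂ (refl , last) | inj₂ (refl , _) = last c₁ (inj₁ (refl , refl))

closeUp-neighbours : ∀ xs → Unique xs → 3 ≤ length xs → x ∈ xs
  → ∃₂ λ s p → s ≢ p × Consec (closeUp xs) x s × Consec (closeUp xs) p x
closeUp-neighbours {x} (c ∷ r) u long x∈
  with Consec-∷ʳ-successor (c ∷ r) x∈ | Consec-∷-predecessor c (r ++ [ c ]) (x∈r∷ʳc x∈)
  where
    x∈r∷ʳc : x ∈ c ∷ r → x ∈ r ++ [ c ]
    x∈r∷ʳc (here e) = ∈-++⁺ʳ r (here e)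
    x∈r∷ʳc (there x∈r) = ∈-++⁺ˡ x∈r
... | s , hs | p , hp = s , p , (λ { refl → closeUp-asym (c ∷ r) u long hs hp }) , hs , hp

firstSatisfying : ∀ {Q : ℕ → Set} xs → Unique xs → U.Decidable Q → Any Q xs
  → ∃[ x ] x ∈ xs × Q x × ∀ {y} → Consec xs y x → ¬ Q y
firstSatisfying {Q} (a ∷ r) (a∉ ∷ u) Q? any with Q? a | any
... | yes qa | _ = a , here refl , qa , λ c _ → All¬⇒¬Any a∉ (Consec-∷⇒∈ʳ a r c)
... | no ¬qa | here qa = ⊥-elim (¬qa qa)
... | no ¬qa | there any′ with firstSatisfying r u Q? any′
...   | x , x∈ , qx , first = x , there x∈ , qx , no-earlier
  where
    no-earlier : ∀ {y} → Consec (a ∷ r) y x → ¬ Q y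
    no-earlier c with Consec-∷⁻ a r c
    ... | inj₁ refl = ¬qa
    ... | inj₂ d = first d

lastSatisfying : ∀ {Q : ℕ → Set} xs → Unique xs → U.Decidable Q → Any Q xs
  → ∃[ x ] x ∈ xs × Q x × ∀ {y} → Consec xs x y → ¬ Q y
lastSatisfying {Q} (a ∷ r) (a∉ ∷ u) Q? any with any? Q? r | any
... | no none | here qa = a , here refl , qa , λ c qy → none (lose (Consec-∷⇒∈ʳ a r c) qy)
... | no none | there any′ = ⊥-elim (none any′)
... | yes any′ | _ with lastSatisfying r u Q? any′
...   | x , x∈ , qx , last = x , there x∈ , qx , no-later
  where
    no-later : ∀ {y} → Consec (a ∷ r) x y → ¬ Q y
    no-later c with Consec-∷⁻ a r c
    ... | inj₁ refl = ⊥-elim (All¬⇒¬Any a∉ x∈)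
    ... | inj₂ d = last d

data Distinct₃ (N : A → Set) : Set where
  distinct₃ : ∀ {u v w} → u ≢ v → u ≢ w → v ≢ w → N u → N v → N w → Distinct₃ N

data Distinct₄ (N : A → Set) : Set where
  distinct₄ : ∀ {u v w t} → u ≢ v → u ≢ w → u ≢ t → v ≢ w → v ≢ t → w ≢ t
    → N u → N v → N w → N t → Distinct₄ N

module _ {N : A → Set} {M : B → Set} {g : A → B} (g-inj : Injective _≡_ _≡_ g)
         (N⇒M : ∀ {a} → N a → M (g a)) where

  Distinct₃-map : Distinct₃ N → Distinct₃ M
  Distinct₃-map (distinct₃ uv uw vw nu nv nw) =
    distinct₃ (uv ∘ g-inj) (uw ∘ g-inj) (vw ∘ g-inj) (N⇒M nu) (N⇒M nv) (N⇒M nw)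

  Distinct₄-map : Distinct₄ N → Distinct₄ M
  Distinct₄-map (distinct₄ uv uw ut vw vt wt nu nv nw nt) =
    distinct₄ (uv ∘ g-inj) (uw ∘ g-inj) (ut ∘ g-inj) (vw ∘ g-inj) (vt ∘ g-inj) (wt ∘ g-inj)
      (N⇒M nu) (N⇒M nv) (N⇒M nw) (N⇒M nt)

Distinct₃-weaken : {N M : A → Set} → (∀ {a} → N a → M a) → Distinct₃ N → Distinct₃ M
Distinct₃-weaken = Distinct₃-map id

Distinct₄-weaken : {N M : A → Set} → (∀ {a} → N a → M a) → Distinct₄ N → Distinct₄ M
Distinct₄-weaken = Distinct₄-map id

module _ {R S : A → Set} (R-one : AtMostOne R) (S-one : AtMostOne S) where

  ¬Distinct₃-⊎ : ¬ Distinct₃ (λ a → R a ⊎ S a)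
  ¬Distinct₃-⊎ (distinct₃ uv _ _ (inj₁ ru) (inj₁ rv) _) = uv (R-one ru rv)
  ¬Distinct₃-⊎ (distinct₃ _ uw _ (inj₁ ru) (inj₂ _) (inj₁ rw)) = uw (R-one ru rw)
  ¬Distinct₃-⊎ (distinct₃ _ _ vw (inj₁ _) (inj₂ sv) (inj₂ sw)) = vw (S-one sv sw)
  ¬Distinct₃-⊎ (distinct₃ uv _ _ (inj₂ su) (inj₂ sv) _) = uv (S-one su sv)
  ¬Distinct₃-⊎ (distinct₃ _ uw _ (inj₂ su) (inj₁ _) (inj₂ sw)) = uw (S-one su sw)
  ¬Distinct₃-⊎ (distinct₃ _ _ vw (inj₂ _) (inj₁ rv) (inj₁ rw)) = vw (R-one rv rw)

  Distinct₃-⊎-escape : ∀ {Pr Y : A → Set} → Distinct₃ (λ a → Pr a × ((R a ⊎ S a) ⊎ Y a)) → ∃[ a ] Pr a × Y a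
  Distinct₃-⊎-escape (distinct₃ _ _ _ (pu , inj₂ yu) _ _) = _ , pu , yu
  Distinct₃-⊎-escape (distinct₃ _ _ _ _ (pv , inj₂ yv) _) = _ , pv , yv
  Distinct₃-⊎-escape (distinct₃ _ _ _ _ _ (pw , inj₂ yw)) = _ , pw , yw
  Distinct₃-⊎-escape (distinct₃ uv uw vw (_ , inj₁ xu) (_ , inj₁ xv) (_ , inj₁ xw)) =
    ⊥-elim (¬Distinct₃-⊎ (distinct₃ uv uw vw xu xv xw))

-- Once the first point is placed in one of the three sets, the other three avoid that set.
Distinct₄-⊎-escape : ∀ {R S T Pr Y : A → Set} → AtMostOne R → AtMostOne S → AtMostOne T
  → Distinct₄ (λ a → Pr a × ((R a ⊎ S a) ⊎ (T a ⊎ Y a))) → ∃[ a ] Pr a × Y a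
Distinct₄-⊎-escape {R = R} {S} {T} {Pr} {Y} R-one S-one T-one (distinct₄ uv uw ut vw vt wt (pu , xu) nv nw nt)
  with xu
... | inj₂ (inj₂ yu) = _ , pu , yu
... | inj₁ (inj₁ ru) = Distinct₃-⊎-escape S-one T-one (distinct₃ vw vt wt (avoidR uv nv) (avoidR uw nw) (avoidR ut nt))
  where
    avoidR : ∀ {a} → _ ≢ a → Pr a × ((R a ⊎ S a) ⊎ (T a ⊎ Y a)) → Pr a × ((S a ⊎ T a) ⊎ Y a)
    avoidR ne (p , inj₁ (inj₁ r)) = ⊥-elim (ne (R-one ru r))
    avoidR ne (p , inj₁ (inj₂ s)) = p , inj₁ (inj₁ s)
    avoidR ne (p , inj₂ (inj₁ t)) = p , inj₁ (inj₂ t)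
    avoidR ne (p , inj₂ (inj₂ y)) = p , inj₂ y
... | inj₁ (inj₂ su) = Distinct₃-⊎-escape R-one T-one (distinct₃ vw vt wt (avoidS uv nv) (avoidS uw nw) (avoidS ut nt))
  where
    avoidS : ∀ {a} → _ ≢ a → Pr a × ((R a ⊎ S a) ⊎ (T a ⊎ Y a)) → Pr a × ((R a ⊎ T a) ⊎ Y a)
    avoidS ne (p , inj₁ (inj₁ r)) = p , inj₁ (inj₁ r)
    avoidS ne (p , inj₁ (inj₂ s)) = ⊥-elim (ne (S-one su s))
    avoidS ne (p , inj₂ (inj₁ t)) = p , inj₁ (inj₂ t)
    avoidS ne (p , inj₂ (inj₂ y)) = p , inj₂ y
... | inj₂ (inj₁ tu) = Distinct₃-⊎-escape R-one S-one (distinct₃ vw vt wt (avoidT uv nv) (avoidT uw nw) (avoidT ut nt))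
  where
    avoidT : ∀ {a} → _ ≢ a → Pr a × ((R a ⊎ S a) ⊎ (T a ⊎ Y a)) → Pr a × ((R a ⊎ S a) ⊎ Y a)
    avoidT ne (p , inj₁ rs) = p , inj₁ rs
    avoidT ne (p , inj₂ (inj₁ t)) = ⊥-elim (ne (T-one tu t))
    avoidT ne (p , inj₂ (inj₂ y)) = p , inj₂ y

UAdj-off-cycle : ∀ C P → x ∉ C → UAdj C P x y → PathAdj P x y
UAdj-off-cycle C P x∉ (inj₁ (inj₁ c)) = ⊥-elim (x∉ (∈-closeUp⁻ C (Consec⇒∈ˡ (closeUp C) c)))
UAdj-off-cycle C P x∉ (inj₁ (inj₂ c)) = ⊥-elim (x∉ (∈-closeUp⁻ C (Consec⇒∈ʳ (closeUp C) c)))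
UAdj-off-cycle C P x∉ (inj₂ p) = p

UAdj-off-path : ∀ C P → x ∉ P → UAdj C P x y → CycleAdj C x y
UAdj-off-path C P x∉ (inj₁ c) = c
UAdj-off-path C P x∉ (inj₂ (inj₁ p)) = ⊥-elim (x∉ (Consec⇒∈ˡ P p))
UAdj-off-path C P x∉ (inj₂ (inj₂ p)) = ⊥-elim (x∉ (Consec⇒∈ʳ P p))

off-cycle-degree≤2 : ∀ C P → Unique P → x ∉ C → ¬ Distinct₃ (UAdj C P x)
off-cycle-degree≤2 C P u x∉ =
  ¬Distinct₃-⊎ (Consec-functionalʳ P u) (Consec-functionalˡ P u) ∘ Distinct₃-weaken (UAdj-off-cycle C P x∉)

off-path-degree≤2 : ∀ C P → Unique C → x ∉ P → ¬ Distinct₃ (UAdj C P x)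
off-path-degree≤2 C P u x∉ =
  ¬Distinct₃-⊎ (closeUp-functionalʳ C u) (closeUp-functionalˡ C u) ∘ Distinct₃-weaken (UAdj-off-path C P x∉)

K5⁻Adj? : Decidable K5⁻Adj
K5⁻Adj? i j = ¬? (i Fin.≟ j) ×-dec ¬? ((i Fin.≟ zero ×-dec j Fin.≟ suc zero) ⊎-dec (i Fin.≟ suc zero ×-dec j Fin.≟ zero))

private
  K5⁻-neighbours₃ : ∀ {i} j k l
    → {True (K5⁻Adj? i j)} → {True (K5⁻Adj? i k)} → {True (K5⁻Adj? i l)}
    → {True (¬? (j Fin.≟ k))} → {True (¬? (j Fin.≟ l))} → {True (¬? (k Fin.≟ l))}
    → Distinct₃ (K5⁻Adj i)
  K5⁻-neighbours₃ j k l {ij} {ik} {il} {jk} {jl} {kl} =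
    distinct₃ (toWitness jk) (toWitness jl) (toWitness kl) (toWitness ij) (toWitness ik) (toWitness il)

  K5⁻-neighbours₄ : ∀ {i} j k l m
    → {True (K5⁻Adj? i j)} → {True (K5⁻Adj? i k)} → {True (K5⁻Adj? i l)} → {True (K5⁻Adj? i m)}
    → {True (¬? (j Fin.≟ k))} → {True (¬? (j Fin.≟ l))} → {True (¬? (j Fin.≟ m))}
    → {True (¬? (k Fin.≟ l))} → {True (¬? (k Fin.≟ m))} → {True (¬? (l Fin.≟ m))}
    → Distinct₄ (K5⁻Adj i)
  K5⁻-neighbours₄ j k l m {ij} {ik} {il} {im} {jk} {jl} {jm} {kl} {km} {lm} =
    distinct₄ (toWitness jk) (toWitness jl) (toWitness jm) (toWitness kl) (toWitness km) (toWitness lm)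
      (toWitness ij) (toWitness ik) (toWitness il) (toWitness im)

K5⁻-degree≥3 : ∀ i → Distinct₃ (K5⁻Adj i)
K5⁻-degree≥3 zero = K5⁻-neighbours₃ (# 2) (# 3) (# 4)
K5⁻-degree≥3 (suc zero) = K5⁻-neighbours₃ (# 2) (# 3) (# 4)
K5⁻-degree≥3 (suc (suc zero)) = K5⁻-neighbours₃ (# 0) (# 1) (# 3)
K5⁻-degree≥3 (suc (suc (suc zero))) = K5⁻-neighbours₃ (# 0) (# 1) (# 2)
K5⁻-degree≥3 (suc (suc (suc (suc zero)))) = K5⁻-neighbours₃ (# 0) (# 1) (# 2)

K5⁻-degree4 : ∀ i → i ≢ # 0 → i ≢ # 1 → Distinct₄ (K5⁻Adj i)
K5⁻-degree4 zero i≢0 _ = ⊥-elim (i≢0 refl)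
K5⁻-degree4 (suc zero) _ i≢1 = ⊥-elim (i≢1 refl)
K5⁻-degree4 (suc (suc zero)) _ _ = K5⁻-neighbours₄ (# 0) (# 1) (# 3) (# 4)
K5⁻-degree4 (suc (suc (suc zero))) _ _ = K5⁻-neighbours₄ (# 0) (# 1) (# 2) (# 4)
K5⁻-degree4 (suc (suc (suc (suc zero)))) _ _ = K5⁻-neighbours₄ (# 0) (# 1) (# 2) (# 3)

module ExceptionalUnion
  (C P C′ P′ : List ℕ) (C-unique : Unique C) (C-long : 3 ≤ length C) (P-unique : Unique P)
  (C′-unique : Unique C′) (P′-unique : Unique P′) (C′⊆P′ : ∀ v → v ∈ C′ → v ∈ P′)
  (f : Fin 5 → ℕ) (f-injective : Injective _≡_ _≡_ f)
  (f-image : ∀ v → v ∈ C′ ⇔ (∃[ i ] f i ≡ v))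
  (f-adjacency : ∀ i j → i ≢ j → (UAdj C′ P′ (f i) (f j) ⇔ K5⁻Adj i j))
  (same-edges : ∀ x y → UAdj C P x y ⇔ UAdj C′ P′ x y) where

  f∈C′ : ∀ i → f i ∈ C′
  f∈C′ i = from (f-image (f i)) (i , refl)

  C′-elim : {Q : ℕ → Set} → (∀ i → Q (f i)) → ∀ {x} → x ∈ C′ → Q x
  C′-elim q x∈ with to (f-image _) x∈
  ... | i , refl = q i

  NeighbourInC′ : ℕ → ℕ → Set
  NeighbourInC′ x w = w ∈ C′ × UAdj C′ P′ x w

  K5⁻Adj⇒NeighbourInC′ : ∀ {i j} → K5⁻Adj i j → NeighbourInC′ (f i) (f j)
  K5⁻Adj⇒NeighbourInC′ {i} {j} adj = f∈C′ j , from (f-adjacency i j (proj₁ adj)) adj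

  C′-degree≥3 : ∀ i → Distinct₃ (NeighbourInC′ (f i))
  C′-degree≥3 i = Distinct₃-map f-injective K5⁻Adj⇒NeighbourInC′ (K5⁻-degree≥3 i)

  C′-degree4 : ∀ i → i ≢ # 0 → i ≢ # 1 → Distinct₄ (NeighbourInC′ (f i))
  C′-degree4 i i≢0 i≢1 = Distinct₄-map f-injective K5⁻Adj⇒NeighbourInC′ (K5⁻-degree4 i i≢0 i≢1)

  C′⊆C : x ∈ C′ → x ∈ C
  C′⊆C = C′-elim λ i → decidable-stable (f i ∈? C) λ f∉C →
    off-cycle-degree≤2 C P P-unique f∉C (Distinct₃-weaken (from (same-edges _ _) ∘ proj₂) (C′-degree≥3 i))

  C′⊆P : x ∈ C′ → x ∈ P
  C′⊆P = C′-elim λ i → decidable-stable (f i ∈? P) λ f∉P →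
    off-path-degree≤2 C P C-unique f∉P (Distinct₃-weaken (from (same-edges _ _) ∘ proj₂) (C′-degree≥3 i))

  C′-cycle-functionalʳ : AtMostOne (Consec (closeUp C′) x)
  C′-cycle-functionalʳ = closeUp-functionalʳ C′ C′-unique

  C′-cycle-functionalˡ : AtMostOne (λ y → Consec (closeUp C′) y x)
  C′-cycle-functionalˡ = closeUp-functionalˡ C′ C′-unique

  PathPredIn PathSuccIn : List ℕ → ℕ → Set
  PathPredIn X x = ∃[ w ] w ∈ X × Consec P′ w x
  PathSuccIn X x = ∃[ w ] w ∈ X × Consec P′ x w

  C′-path-neighbour : x ∈ C′ → PathPredIn C′ x ⊎ PathSuccIn C′ x
  C′-path-neighbour = C′-elim {λ x → PathPredIn C′ x ⊎ PathSuccIn C′ x} (orient ∘ escape)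
    where
      escape : ∀ i → ∃[ w ] w ∈ C′ × PathAdj P′ (f i) w
      escape i = Distinct₃-⊎-escape C′-cycle-functionalʳ C′-cycle-functionalˡ (C′-degree≥3 i)
      orient : (∃[ w ] w ∈ C′ × PathAdj P′ x w) → PathPredIn C′ x ⊎ PathSuccIn C′ x
      orient (w , w∈ , inj₁ x→w) = inj₂ (w , w∈ , x→w)
      orient (w , w∈ , inj₂ w→x) = inj₁ (w , w∈ , w→x)

  C′-path-neighbours : ∀ i → i ≢ # 0 → i ≢ # 1 → PathPredIn C′ (f i) × PathSuccIn C′ (f i)
  C′-path-neighbours i i≢0 i≢1 =
      Distinct₄-⊎-escape C′-cycle-functionalʳ C′-cycle-functionalˡ (Consec-functionalʳ P′ P′-unique) degree4
    , Distinct₄-⊎-escape C′-cycle-functionalʳ C′-cycle-functionalˡ (Consec-functionalˡ P′ P′-unique)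
        (Distinct₄-weaken (Product.map₂ (Sum.map₂ Sum.swap)) degree4)
    where
      degree4 : Distinct₄ (NeighbourInC′ (f i))
      degree4 = C′-degree4 i i≢0 i≢1

  MissingEdgeEnd : ℕ → Set
  MissingEdgeEnd x = x ≡ f (# 0) ⊎ x ≡ f (# 1)

  ¬Distinct₃-MissingEdgeEnd : ¬ Distinct₃ MissingEdgeEnd
  ¬Distinct₃-MissingEdgeEnd = ¬Distinct₃-⊎ (λ e e′ → trans e (sym e′)) (λ e e′ → trans e (sym e′))

  C′-classify : x ∈ C′ → MissingEdgeEnd x ⊎ (PathPredIn C′ x × PathSuccIn C′ x)
  C′-classify = C′-elim classify
    where
      classify : ∀ i → MissingEdgeEnd (f i) ⊎ (PathPredIn C′ (f i) × PathSuccIn C′ (f i))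
      classify i with i Fin.≟ # 0 | i Fin.≟ # 1
      ... | yes refl | _ = inj₁ (inj₁ refl)
      ... | no _ | yes refl = inj₁ (inj₂ refl)
      ... | no i≢0 | no i≢1 = inj₂ (C′-path-neighbours i i≢0 i≢1)

  PathPredIn-C′⇒C : PathPredIn C′ x → PathPredIn C x
  PathPredIn-C′⇒C = Product.map₂ (Product.map₁ C′⊆C)

  PathSuccIn-C′⇒C : PathSuccIn C′ x → PathSuccIn C x
  PathSuccIn-C′⇒C = Product.map₂ (Product.map₁ C′⊆C)

  C∖C′-path-neighbours : x ∈ C → x ∉ C′ → PathPredIn C x × PathSuccIn C x
  C∖C′-path-neighbours {x} x∈C x∉C′ with closeUp-neighbours C C-unique C-long x∈C
  ... | s , p , s≢p , hs , hp =
    PathAdj-distinct⇒pred×succ P′ P′-unique s≢p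
      (∈-closeUp⁻ C (Consec⇒∈ʳ (closeUp C) hs)) (∈-closeUp⁻ C (Consec⇒∈ˡ (closeUp C) hp))
      (UAdj-off-cycle C′ P′ x∉C′ (to (same-edges x s) (inj₁ (inj₁ hs))))
      (UAdj-off-cycle C′ P′ x∉C′ (to (same-edges x p) (inj₁ (inj₂ hp))))

  C∖C′⊆P′ : x ∈ C → x ∉ C′ → x ∈ P′
  C∖C′⊆P′ x∈C x∉C′ with proj₁ (C∖C′-path-neighbours x∈C x∉C′)
  ... | _ , _ , w→x = Consec⇒∈ʳ P′ w→x

  first-of-C : x ∈ C → ¬ PathPredIn C x → MissingEdgeEnd x × PathSuccIn C′ x
  first-of-C {x} x∈C no-pred with C′-classify x∈C′ | C′-path-neighbour x∈C′
    where
      x∈C′ : x ∈ C′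
      x∈C′ = decidable-stable (x ∈? C′) (no-pred ∘ proj₁ ∘ C∖C′-path-neighbours x∈C)
  ... | inj₂ (pred , _) | _ = ⊥-elim (no-pred (PathPredIn-C′⇒C pred))
  ... | inj₁ _ | inj₁ pred = ⊥-elim (no-pred (PathPredIn-C′⇒C pred))
  ... | inj₁ end | inj₂ succ = end , succ

  last-of-C : x ∈ C → ¬ PathSuccIn C x → MissingEdgeEnd x
  last-of-C {x} x∈C no-succ with C′-classify x∈C′
    where
      x∈C′ : x ∈ C′
      x∈C′ = decidable-stable (x ∈? C′) (no-succ ∘ proj₂ ∘ C∖C′-path-neighbours x∈C)
  ... | inj₂ (_ , succ) = ⊥-elim (no-succ (PathSuccIn-C′⇒C succ))
  ... | inj₁ end = end

  successor-in-C′ : Consec P′ x y → PathSuccIn C′ x → y ∈ C′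
  successor-in-C′ x→y (w , w∈ , x→w) = subst (_∈ C′) (Consec-functionalʳ P′ P′-unique x→w x→y) w∈

  exit-of-C′ : x ∈ C′ → y ∉ C′ → Consec P′ x y → MissingEdgeEnd x × PathPredIn C′ x
  exit-of-C′ x∈C′ y∉C′ x→y with C′-classify x∈C′ | C′-path-neighbour x∈C′
  ... | inj₂ (_ , succ) | _ = ⊥-elim (y∉C′ (successor-in-C′ x→y succ))
  ... | inj₁ _ | inj₂ succ = ⊥-elim (y∉C′ (successor-in-C′ x→y succ))
  ... | inj₁ end | inj₁ pred = end , pred

  C∩P′-nonempty : Any (_∈ C) P′
  C∩P′-nonempty = lose (C′⊆P′ _ (f∈C′ (# 0))) (C′⊆C (f∈C′ (# 0)))

  no-exit-within-C : x ∈ C′ → y ∈ C → y ∉ C′ → ¬ Consec P′ x y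
  no-exit-within-C {x} x∈C′ y∈C y∉C′ x→y
    with firstSatisfying P′ P′-unique (_∈? C) C∩P′-nonempty | lastSatisfying P′ P′-unique (_∈? C) C∩P′-nonempty
  ... | z₀ , _ , z₀∈C , first | z₁ , _ , z₁∈C , last
    with first-of-C z₀∈C (λ (w , w∈C , w→z₀) → first w→z₀ w∈C)
       | last-of-C z₁∈C (λ (w , w∈C , z₁→w) → last z₁→w w∈C)
       | exit-of-C′ x∈C′ y∉C′ x→y
  ... | end₀ , (s , s∈C′ , z₀→s) | end₁ | end , (q , q∈C′ , q→x) =
    ¬Distinct₃-MissingEdgeEnd (distinct₃ z₀≢z₁ z₀≢x z₁≢x end₀ end₁ end)
    where
      z₀≢z₁ : z₀ ≢ z₁
      z₀≢z₁ refl = last z₀→s (C′⊆C s∈C′)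
      z₀≢x : z₀ ≢ x
      z₀≢x refl = first q→x (C′⊆C q∈C′)
      z₁≢x : z₁ ≢ x
      z₁≢x refl = last x→y y∈C

  C⊆C′ : x ∈ C → x ∈ C′
  C⊆C′ {x} x∈C = decidable-stable (x ∈? C′) λ x∉C′ →
    exit (firstSatisfying P′ P′-unique (λ v → v ∈? C ×-dec ¬? (v ∈? C′)) (lose (C∖C′⊆P′ x∈C x∉C′) (x∈C , x∉C′)))
    where
      exit : ¬ (∃[ y ] y ∈ P′ × (y ∈ C × y ∉ C′) × ∀ {w} → Consec P′ w y → ¬ (w ∈ C × w ∉ C′))
      exit (y , _ , (y∈C , y∉C′) , first) with proj₁ (C∖C′-path-neighbours y∈C y∉C′)
      ... | p , p∈C , p→y =
        no-exit-within-C (decidable-stable (p ∈? C′) λ p∉C′ → first p→y (p∈C , p∉C′)) y∈C y∉C′ p→y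

Unique-same-elements⇒length-≡ : ∀ {xs ys : List ℕ} → Unique xs → Unique ys → (∀ v → v ∈ xs ⇔ v ∈ ys)
  → length xs ≡ length ys
Unique-same-elements⇒length-≡ xs-unique ys-unique same =
  ↭-length (∼bag⇒↭ (unique∧set⇒bag xs-unique ys-unique λ {v} → same v))

mainTheorem6 : (C P : List ℕ) → IsCycle C → IsPath P → EdgeDisjoint C P
    → Exceptional C P
    → length C ≡ 5 × (∀ v → v ∈ C → v ∈ P) × InducesK5⁻ (UAdj C P) C
mainTheorem6 C P (C-unique , C-long) (P-unique , _) _
  (C′ , P′ , (C′-unique , _) , C′-length , (P′-unique , _) , _ , C′⊆P′ , (f , f-injective , f-image , f-adjacency)
  , (_ , same-edges)) =
    trans (Unique-same-elements⇒length-≡ C-unique C′-unique C≐C′) C′-length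
  , (λ _ → C′⊆P ∘ C⊆C′)
  , f , f-injective , (λ v → f-image v ⇔-∘ C≐C′ v) , (λ i j i≢j → f-adjacency i j i≢j ⇔-∘ same-edges (f i) (f j))
  where
    open ExceptionalUnion C P C′ P′ C-unique C-long P-unique C′-unique P′-unique C′⊆P′
      f f-injective f-image f-adjacency same-edges

    C≐C′ : ∀ v → v ∈ C ⇔ v ∈ C′
    C≐C′ v = mk⇔ C⊆C′ C′⊆C
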